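{- Let $p$ be a prime, let $N\ge1$ and let $e_1,\ldots,e_N$ be integers. There exists a constant $C_1$ (depending on $p$, $N$ and the $e_i$) such that for all $u_1,\ldots,u_N\in\mathbb{Z}$ satisfying (i) $\sum_{i=1}^N e_ip^{u_i}\in\mathbb{Z}\setminus\{0\}$ and (ii) there is no nonempty proper subset $J\subset\{1,\ldots,N\}$ with $\sum_{i\in J}e_ip^{u_i}=0$, we have $u_i+C_1\ge 0$ for every $1\le i\le N$. -}

module Defs where

open import Data.Nat as ℕ using (ℕ; zero; suc)
open import Data.Nat.Primality using (Prime; prime⇒nonZero)
open import Data.Nat.Properties using (m^n≢0)
open import Data.Integer as ℤ using (ℤ; +_; -[1+_])
open import Data.Rational as ℚ using (ℚ; 0ℚ; _/_; _+_; _*_)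
open import Data.Fin using (Fin; zero; suc)
open import Data.Fin.Subset using (Subset; inside; outside)
open import Data.Vec using (lookup)
open import Data.Bool using (true; false)

zpow : (p : ℕ) → Prime p → ℤ → ℚ
zpow p pp (+ n) = (+ (p ℕ.^ n)) / 1
zpow p pp -[1+ n ] = (+ 1) / (p ℕ.^ suc n)
  where instance
    _ = prime⇒nonZero pp
    _ = m^n≢0 p (suc n)

ℤ→ℚ : ℤ → ℚ
ℤ→ℚ z = z / 1

∑ : ∀ {n} → (Fin n → ℚ) → ℚ
∑ {zero} f = 0ℚ
∑ {suc n} f = f zero + ∑ (λ i → f (suc i))

∑[∈] : ∀ {n} → Subset n → (Fin n → ℚ) → ℚ
∑[∈] J f = ∑ (λ i → sel (lookup J i) (f i))
  where
    sel : _ → ℚ → ℚ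
    sel true q = q
    sel false q = 0ℚ

term : (p : ℕ) → Prime p → ∀ {N} → (Fin N → ℤ) → (Fin N → ℤ) → Fin N → ℚ
term p pp e u i = ℤ→ℚ (e i) * zpow p pp (u i)

-- Let u₀ = min uᵢ and suppose u₀ = -D < 0. Multiplying by p^D turns Σ eᵢ p^{uᵢ} = z into the
-- integer identity Σ eᵢ p^{wᵢ} = z p^D with wᵢ = uᵢ + D ≥ 0 and some wᵢ = 0. Cut ℕ into layers of
-- width c = 1 + Σ |eᵢ|; layer 0 holds a wᵢ, so by pigeonhole one of the layers 1, …, N, say k,
-- holds none. The terms in layers below k sum to less than p^c · p^{kc} = p^{(k+1)c} in absolute
-- value, while the terms above k are divisible by p^{(k+1)c}, and so is z p^D once D ≥ (N + 1) c.
-- Hence the lower terms form a vanishing subsum containing the minimum: it is either the whole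
-- sum, contradicting z ≠ 0, or a proper one, contradicting irreducibility. So u₀ + (N + 1) c ≥ 0.

module Submission where

open import Defs
open import Data.Nat using (ℕ; _≤_)
open import Data.Nat.Primality using (Prime)
open import Data.Integer using (ℤ; _+_; 0ℤ) renaming (_≤_ to _≤ℤ_)
open import Data.Rational using (0ℚ)
open import Data.Fin using (Fin)
open import Data.Fin.Subset using (Subset; Nonempty; ⊤)
open import Data.Product using (∃-syntax; _×_)
open import Relation.Binary.PropositionalEquality using (_≡_; _≢_)

open import Function using (_∘_)
open import Data.Bool using (true; false)
open import Data.Bool.Properties using () renaming (_≟_ to _≟ᵇ_)
open import Data.Empty using (⊥; ⊥-elim)
open import Data.Sum using (_⊎_; inj₁; inj₂)
open import Data.Product using (∃; _,_; proj₁; proj₂; map₂)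
open import Data.Nat as ℕ using (zero; suc; _^_; _<_; z≤n; s≤s; NonZero; NonTrivial)
import Data.Nat.Properties as ℕP
open import Data.Nat.DivMod using (_/_; m*n/n≡m; m/n*n≤m; /-monoˡ-≤; 0/n≡0)
open import Data.Nat.Divisibility as ℕ∣ using (>⇒∤)
open import Data.Nat.Primality using (prime⇒nonZero; prime⇒nonTrivial)
open import Data.Integer as ℤ using (+_; -[1+_]; ∣_∣; +≤+)
import Data.Integer.Properties as ℤP
open import Data.Integer.Divisibility.Signed
  using (_∣_; divides; ∣ᵤ⇒∣; ∣⇒∣ᵤ; ∣-trans; ∣m+n∣n⇒∣m; ∣m∣n⇒∣m+n; ∣n⇒∣m*n)
open import Data.Rational as ℚ using (ℚ; 1ℚ; toℚᵘ; fromℚᵘ)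
open import Data.Rational.Properties
  using (fromℚᵘ-injective; fromℚᵘ-cong; fromℚᵘ-toℚᵘ; toℚᵘ-fromℚᵘ; toℚᵘ-homo-+; toℚᵘ-homo-*)
import Data.Rational.Properties as ℚP
open import Data.Rational.Unnormalised as ℚᵘ using (mkℚᵘ; *≡*)
import Data.Rational.Unnormalised.Properties as ℚᵘP
open import Data.Fin using (zero; suc; toℕ)
open import Data.Fin.Properties using (toℕ<n; toℕ-injective; injective⇒≤; punchOut-injective; ¬∀⟶∃¬; any?)
open import Data.Fin.Subset using (_∈_; ∁)
open import Data.Fin.Subset.Properties using (x∈∁p⇒x∉p)
open import Data.Vec using ([]; _∷_; here; there)
open import Data.Vec.Properties using (≡-dec)
open import Algebra.Properties.Semiring.Sum ℕP.+-*-semiring using (sum; *-distribʳ-sum)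
open import Algebra.Properties.CommutativeSemigroup ℤP.+-commutativeSemigroup using (x∙yz≈y∙xz)
open import Relation.Binary.Bundles using (TotalPreorder)
open import Relation.Binary.PropositionalEquality using (refl; sym; trans; cong; cong₂; subst; module ≡-Reasoning)
open import Relation.Nullary using (¬_; yes; no; does; contradiction)
open import Relation.Unary using (Pred; Decidable)

fromℚᵘ-homo-+ : ∀ x y → fromℚᵘ (x ℚᵘ.+ y) ≡ fromℚᵘ x ℚ.+ fromℚᵘ y
fromℚᵘ-homo-+ x y = begin
  fromℚᵘ (x ℚᵘ.+ y)                              ≡⟨ fromℚᵘ-cong (ℚᵘP.+-cong (toℚᵘ-fromℚᵘ x) (toℚᵘ-fromℚᵘ y)) ⟨
  fromℚᵘ (toℚᵘ (fromℚᵘ x) ℚᵘ.+ toℚᵘ (fromℚᵘ y))  ≡⟨ fromℚᵘ-cong (toℚᵘ-homo-+ (fromℚᵘ x) (fromℚᵘ y)) ⟨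
  fromℚᵘ (toℚᵘ (fromℚᵘ x ℚ.+ fromℚᵘ y))          ≡⟨ fromℚᵘ-toℚᵘ (fromℚᵘ x ℚ.+ fromℚᵘ y) ⟩
  fromℚᵘ x ℚ.+ fromℚᵘ y                          ∎
  where open ≡-Reasoning

fromℚᵘ-homo-* : ∀ x y → fromℚᵘ (x ℚᵘ.* y) ≡ fromℚᵘ x ℚ.* fromℚᵘ y
fromℚᵘ-homo-* x y = begin
  fromℚᵘ (x ℚᵘ.* y)                              ≡⟨ fromℚᵘ-cong (ℚᵘP.*-cong (toℚᵘ-fromℚᵘ x) (toℚᵘ-fromℚᵘ y)) ⟨
  fromℚᵘ (toℚᵘ (fromℚᵘ x) ℚᵘ.* toℚᵘ (fromℚᵘ y))  ≡⟨ fromℚᵘ-cong (toℚᵘ-homo-* (fromℚᵘ x) (fromℚᵘ y)) ⟨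
  fromℚᵘ (toℚᵘ (fromℚᵘ x ℚ.* fromℚᵘ y))          ≡⟨ fromℚᵘ-toℚᵘ (fromℚᵘ x ℚ.* fromℚᵘ y) ⟩
  fromℚᵘ x ℚ.* fromℚᵘ y                          ∎
  where open ≡-Reasoning

-- ℤ→ℚ i is definitionally fromℚᵘ (mkℚᵘ i 0), which transfers the ring laws of ℚᵘ.
ℤ→ℚ-homo-+ : ∀ i j → ℤ→ℚ (i ℤ.+ j) ≡ ℤ→ℚ i ℚ.+ ℤ→ℚ j
ℤ→ℚ-homo-+ i j = trans
  (cong (λ k → fromℚᵘ (mkℚᵘ k 0)) (sym (cong₂ ℤ._+_ (ℤP.*-identityʳ i) (ℤP.*-identityʳ j))))
  (fromℚᵘ-homo-+ (mkℚᵘ i 0) (mkℚᵘ j 0))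

ℤ→ℚ-homo-* : ∀ i j → ℤ→ℚ (i ℤ.* j) ≡ ℤ→ℚ i ℚ.* ℤ→ℚ j
ℤ→ℚ-homo-* i j = fromℚᵘ-homo-* (mkℚᵘ i 0) (mkℚᵘ j 0)

ℤ→ℚ-injective : ∀ {i j} → ℤ→ℚ i ≡ ℤ→ℚ j → i ≡ j
ℤ→ℚ-injective {i} {j} eq with fromℚᵘ-injective {mkℚᵘ i 0} {mkℚᵘ j 0} eq
... | *≡* i*1≡j*1 = trans (sym (ℤP.*-identityʳ i)) (trans i*1≡j*1 (ℤP.*-identityʳ j))

1/n*n≡1 : ∀ n .{{_ : NonZero n}} → ((+ 1) ℚ./ n) ℚ.* ℤ→ℚ (+ n) ≡ 1ℚ
1/n*n≡1 (suc m) = trans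
  (sym (fromℚᵘ-homo-* (mkℚᵘ (+ 1) m) (mkℚᵘ (+ suc m) 0)))
  (fromℚᵘ-cong (ℚᵘP.*-inverseˡ (mkℚᵘ (+ suc m) 0)))

x*n≡0⇒x≡0 : ∀ n .{{_ : NonZero n}} {x} → x ℚ.* ℤ→ℚ (+ n) ≡ 0ℚ → x ≡ 0ℚ
x*n≡0⇒x≡0 n {x} x*n≡0 = begin
  x                                         ≡⟨ ℚP.*-identityʳ x ⟨
  x ℚ.* 1ℚ                                  ≡⟨ cong (x ℚ.*_) (trans (ℚP.*-comm (ℤ→ℚ (+ n)) ((+ 1) ℚ./ n)) (1/n*n≡1 n)) ⟨
  x ℚ.* (ℤ→ℚ (+ n) ℚ.* ((+ 1) ℚ./ n))       ≡⟨ ℚP.*-assoc x (ℤ→ℚ (+ n)) ((+ 1) ℚ./ n) ⟨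
  (x ℚ.* ℤ→ℚ (+ n)) ℚ.* ((+ 1) ℚ./ n)       ≡⟨ cong (ℚ._* ((+ 1) ℚ./ n)) x*n≡0 ⟩
  0ℚ ℚ.* ((+ 1) ℚ./ n)                      ≡⟨ ℚP.*-zeroˡ ((+ 1) ℚ./ n) ⟩
  0ℚ                                        ∎
  where open ≡-Reasoning

ℤ→ℚ-^-+ : ∀ p m n → ℤ→ℚ (+ (p ^ (m ℕ.+ n))) ≡ ℤ→ℚ (+ (p ^ m)) ℚ.* ℤ→ℚ (+ (p ^ n))
ℤ→ℚ-^-+ p m n = trans
  (cong ℤ→ℚ (trans (cong +_ (ℕP.^-distribˡ-+-* p m n)) (ℤP.pos-* (p ^ m) (p ^ n))))
  (ℤ→ℚ-homo-* (+ (p ^ m)) (+ (p ^ n)))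

zpow-*-^ : ∀ p (pp : Prime p) u {D w} → u ℤ.+ + D ≡ + w →
           zpow p pp u ℚ.* ℤ→ℚ (+ (p ^ D)) ≡ ℤ→ℚ (+ (p ^ w))
zpow-*-^ p pp (+ n) {D} u+D≡w = trans
  (sym (ℤ→ℚ-^-+ p n D))
  (cong (λ k → ℤ→ℚ (+ (p ^ k))) (ℤP.+-injective u+D≡w))
zpow-*-^ p pp -[1+ n ] {D} {w} u+D≡w = begin
  P⁻¹ ℚ.* ℤ→ℚ (+ (p ^ D))                         ≡⟨ cong (λ k → P⁻¹ ℚ.* ℤ→ℚ (+ (p ^ k))) D≡1+n+w ⟩
  P⁻¹ ℚ.* ℤ→ℚ (+ (p ^ (suc n ℕ.+ w)))             ≡⟨ cong (P⁻¹ ℚ.*_) (ℤ→ℚ-^-+ p (suc n) w) ⟩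
  P⁻¹ ℚ.* (ℤ→ℚ (+ P) ℚ.* ℤ→ℚ (+ (p ^ w)))        ≡⟨ ℚP.*-assoc P⁻¹ (ℤ→ℚ (+ P)) (ℤ→ℚ (+ (p ^ w))) ⟨
  (P⁻¹ ℚ.* ℤ→ℚ (+ P)) ℚ.* ℤ→ℚ (+ (p ^ w))        ≡⟨ cong (ℚ._* ℤ→ℚ (+ (p ^ w))) (1/n*n≡1 P) ⟩
  1ℚ ℚ.* ℤ→ℚ (+ (p ^ w))                          ≡⟨ ℚP.*-identityˡ (ℤ→ℚ (+ (p ^ w))) ⟩
  ℤ→ℚ (+ (p ^ w))                                 ∎
  where
  open ≡-Reasoning
  instance
    _ = ℕP.m^n≢0 p (suc n) {{prime⇒nonZero pp}}
  P = p ^ suc n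
  P⁻¹ = (+ 1) ℚ./ P
  D≡1+n+w : D ≡ suc n ℕ.+ w
  D≡1+n+w = ℤP.+-injective (begin
    + D                                 ≡⟨ ℤP.+-identityˡ (+ D) ⟨
    0ℤ ℤ.+ + D                          ≡⟨ cong (ℤ._+ + D) (ℤP.+-inverseʳ (+ suc n)) ⟨
    (+ suc n ℤ.+ -[1+ n ]) ℤ.+ + D      ≡⟨ ℤP.+-assoc (+ suc n) -[1+ n ] (+ D) ⟩
    + suc n ℤ.+ (-[1+ n ] ℤ.+ + D)      ≡⟨ cong (ℤ._+_ (+ suc n)) u+D≡w ⟩
    + (suc n ℕ.+ w)                     ∎)

n<m^n : ∀ {m} → 1 < m → ∀ n → n < m ^ n
n<m^n 1<m zero    = s≤s z≤n
n<m^n 1<m (suc n) = ℕP.≤-<-trans (n<m^n 1<m n) (ℕP.^-monoʳ-< _ 1<m (ℕP.n<1+n n))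

^-monoʳ-∣ : ∀ p {m n} → m ≤ n → p ^ m ℕ∣.∣ p ^ n
^-monoʳ-∣ p {m} {n} m≤n = subst (p ^ m ℕ∣.∣_)
  (trans (sym (ℕP.^-distribˡ-+-* p m (n ℕ.∸ m))) (cong (p ^_) (ℕP.m+[n∸m]≡n m≤n)))
  (ℕ∣.m∣m*n (p ^ (n ℕ.∸ m)))

m/n<o⇒m<o*n : ∀ {m n o} .{{_ : NonZero n}} → m / n < o → m < o ℕ.* n
m/n<o⇒m<o*n {m} {n} {o} m/n<o = ℕP.≰⇒> λ o*n≤m →
  ℕP.<⇒≱ m/n<o (ℕP.≤-trans (ℕP.≤-reflexive (sym (m*n/n≡m o n))) (/-monoˡ-≤ n o*n≤m))

o≤m/n⇒o*n≤m : ∀ {m n o} .{{_ : NonZero n}} → o ≤ m / n → o ℕ.* n ≤ m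
o≤m/n⇒o*n≤m {m} {n} o≤m/n = ℕP.≤-trans (ℕP.*-monoˡ-≤ n o≤m/n) (m/n*n≤m m n)

n∣i∧∣i∣<n⇒i≡0 : ∀ {n i} → + n ∣ i → ∣ i ∣ < n → i ≡ 0ℤ
n∣i∧∣i∣<n⇒i≡0 n∣i ∣i∣<n = ℤP.∣i∣≡0⇒i≡0 (m∣k∧k<m⇒k≡0 (∣⇒∣ᵤ n∣i) ∣i∣<n)
  where
  m∣k∧k<m⇒k≡0 : ∀ {m k} → m ℕ∣.∣ k → k < m → k ≡ 0
  m∣k∧k<m⇒k≡0 {k = zero}  _   _   = refl
  m∣k∧k<m⇒k≡0 {k = suc _} m∣k k<m = contradiction m∣k (>⇒∤ k<m)

0≤i+n⊎i+D≡0 : ∀ i n → 0ℤ ≤ℤ i ℤ.+ + n ⊎ ∃ λ D → n ≤ D × i ℤ.+ + D ≡ 0ℤ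
0≤i+n⊎i+D≡0 (+ m)     n = inj₁ (+≤+ z≤n)
0≤i+n⊎i+D≡0 -[1+ m ] n with n ℕ.≤? suc m
... | yes n≤1+m = inj₂ (suc m , n≤1+m , ℤP.+-inverseˡ (+ suc m))
... | no  n≰1+m = inj₁ (subst (0ℤ ≤ℤ_) (sym (ℤP.⊖-≥ (ℕP.<⇒≤ (ℕP.≰⇒> n≰1+m)))) (+≤+ z≤n))

toSubset : ∀ {n ℓ} {P : Pred (Fin n) ℓ} → Decidable P → Subset n
toSubset {zero}  P? = []
toSubset {suc n} P? = does (P? zero) ∷ toSubset (P? ∘ suc)

∈-toSubset⁺ : ∀ {n ℓ} {P : Pred (Fin n) ℓ} (P? : Decidable P) {i} → P i → i ∈ toSubset P?
∈-toSubset⁺ P? {zero} Pi with P? zero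
... | yes _   = here
... | no  ¬Pi = contradiction Pi ¬Pi
∈-toSubset⁺ P? {suc i} Pi = there (∈-toSubset⁺ (P? ∘ suc) Pi)

∈-toSubset⁻ : ∀ {n ℓ} {P : Pred (Fin n) ℓ} (P? : Decidable P) {i} → i ∈ toSubset P? → P i
∈-toSubset⁻ P? {zero} i∈P with P? zero | i∈P
... | yes Pi | _ = Pi
... | no  _  | ()
∈-toSubset⁻ P? {suc i} (there i∈P) = ∈-toSubset⁻ (P? ∘ suc) i∈P

∑[∈]-⊤ : ∀ {n} (f : Fin n → ℚ) → ∑[∈] ⊤ f ≡ ∑ f
∑[∈]-⊤ {zero}  f = refl
∑[∈]-⊤ {suc n} f = cong (f zero ℚ.+_) (∑[∈]-⊤ (f ∘ suc))

∑ᶻ[∈] : ∀ {n} → Subset n → (Fin n → ℤ) → ℤ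
∑ᶻ[∈] []          g = 0ℤ
∑ᶻ[∈] (true  ∷ J) g = g zero ℤ.+ ∑ᶻ[∈] J (g ∘ suc)
∑ᶻ[∈] (false ∷ J) g = ∑ᶻ[∈] J (g ∘ suc)

∑[∈]-*-ℤ→ℚ : ∀ {n} (J : Subset n) {f : Fin n → ℚ} {g : Fin n → ℤ} (q : ℚ) →
             (∀ i → f i ℚ.* q ≡ ℤ→ℚ (g i)) → ∑[∈] J f ℚ.* q ≡ ℤ→ℚ (∑ᶻ[∈] J g)
∑[∈]-*-ℤ→ℚ []          q fq≡g = ℚP.*-zeroˡ q
∑[∈]-*-ℤ→ℚ (true  ∷ J) {f} {g} q fq≡g = begin
  (f zero ℚ.+ ∑[∈] J (f ∘ suc)) ℚ.* q           ≡⟨ ℚP.*-distribʳ-+ q (f zero) (∑[∈] J (f ∘ suc)) ⟩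
  f zero ℚ.* q ℚ.+ ∑[∈] J (f ∘ suc) ℚ.* q       ≡⟨ cong₂ ℚ._+_ (fq≡g zero) (∑[∈]-*-ℤ→ℚ J q (fq≡g ∘ suc)) ⟩
  ℤ→ℚ (g zero) ℚ.+ ℤ→ℚ (∑ᶻ[∈] J (g ∘ suc))      ≡⟨ ℤ→ℚ-homo-+ (g zero) (∑ᶻ[∈] J (g ∘ suc)) ⟨
  ℤ→ℚ (g zero ℤ.+ ∑ᶻ[∈] J (g ∘ suc))            ∎
  where open ≡-Reasoning
∑[∈]-*-ℤ→ℚ (false ∷ J) {f} q fq≡g =
  trans (cong (ℚ._* q) (ℚP.+-identityˡ (∑[∈] J (f ∘ suc)))) (∑[∈]-*-ℤ→ℚ J q (fq≡g ∘ suc))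

∑[∈]-term-* : ∀ p (pp : Prime p) {n} (e u : Fin n → ℤ) {D} {w : Fin n → ℕ} →
              (∀ i → u i ℤ.+ + D ≡ + w i) → ∀ J →
              ∑[∈] J (term p pp e u) ℚ.* ℤ→ℚ (+ (p ^ D)) ≡ ℤ→ℚ (∑ᶻ[∈] J (λ i → e i ℤ.* + (p ^ w i)))
∑[∈]-term-* p pp e u {D} {w} u+D≡w J = ∑[∈]-*-ℤ→ℚ J (ℤ→ℚ (+ (p ^ D))) λ i → begin
  ℤ→ℚ (e i) ℚ.* zpow p pp (u i) ℚ.* ℤ→ℚ (+ (p ^ D))      ≡⟨ ℚP.*-assoc (ℤ→ℚ (e i)) (zpow p pp (u i)) (ℤ→ℚ (+ (p ^ D))) ⟩
  ℤ→ℚ (e i) ℚ.* (zpow p pp (u i) ℚ.* ℤ→ℚ (+ (p ^ D)))    ≡⟨ cong (ℤ→ℚ (e i) ℚ.*_) (zpow-*-^ p pp (u i) (u+D≡w i)) ⟩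
  ℤ→ℚ (e i) ℚ.* ℤ→ℚ (+ (p ^ w i))                        ≡⟨ ℤ→ℚ-homo-* (e i) (+ (p ^ w i)) ⟨
  ℤ→ℚ (e i ℤ.* + (p ^ w i))                              ∎
  where open ≡-Reasoning

∑ᶻ[∈]-∁ : ∀ {n} (J : Subset n) (g : Fin n → ℤ) → ∑ᶻ[∈] J g ℤ.+ ∑ᶻ[∈] (∁ J) g ≡ ∑ᶻ[∈] ⊤ g
∑ᶻ[∈]-∁ []          g = refl
∑ᶻ[∈]-∁ (true  ∷ J) g = trans
  (ℤP.+-assoc (g zero) (∑ᶻ[∈] J (g ∘ suc)) (∑ᶻ[∈] (∁ J) (g ∘ suc)))
  (cong (ℤ._+_ (g zero)) (∑ᶻ[∈]-∁ J (g ∘ suc)))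
∑ᶻ[∈]-∁ (false ∷ J) g = trans
  (x∙yz≈y∙xz (∑ᶻ[∈] J (g ∘ suc)) (g zero) (∑ᶻ[∈] (∁ J) (g ∘ suc)))
  (cong (ℤ._+_ (g zero)) (∑ᶻ[∈]-∁ J (g ∘ suc)))

∣-∑ᶻ[∈] : ∀ {n} (J : Subset n) {m : ℤ} {g : Fin n → ℤ} → (∀ i → i ∈ J → m ∣ g i) → m ∣ ∑ᶻ[∈] J g
∣-∑ᶻ[∈] []          m∣g = divides 0ℤ refl
∣-∑ᶻ[∈] (true  ∷ J) m∣g = ∣m∣n⇒∣m+n (m∣g zero here) (∣-∑ᶻ[∈] J (λ i → m∣g (suc i) ∘ there))
∣-∑ᶻ[∈] (false ∷ J) m∣g = ∣-∑ᶻ[∈] J (λ i → m∣g (suc i) ∘ there)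

∣∑ᶻ[∈]∣≤ : ∀ {n} (J : Subset n) {g : Fin n → ℤ} (b : Fin n → ℕ) →
           (∀ i → i ∈ J → ∣ g i ∣ ≤ b i) → ∣ ∑ᶻ[∈] J g ∣ ≤ sum b
∣∑ᶻ[∈]∣≤ []               b ∣g∣≤b = z≤n
∣∑ᶻ[∈]∣≤ (true  ∷ J) {g} b ∣g∣≤b = ℕP.≤-trans
  (ℤP.∣i+j∣≤∣i∣+∣j∣ (g zero) (∑ᶻ[∈] J (g ∘ suc)))
  (ℕP.+-mono-≤ (∣g∣≤b zero here) (∣∑ᶻ[∈]∣≤ J (b ∘ suc) (λ i → ∣g∣≤b (suc i) ∘ there)))
∣∑ᶻ[∈]∣≤ (false ∷ J)     b ∣g∣≤b = ℕP.≤-trans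
  (∣∑ᶻ[∈]∣≤ J (b ∘ suc) (λ i → ∣g∣≤b (suc i) ∘ there))
  (ℕP.m≤n+m (sum (b ∘ suc)) (b zero))

small-subsum≡0 : ∀ {n} (J : Subset n) (g : Fin n → ℤ) {m} → + m ∣ ∑ᶻ[∈] ⊤ g →
                 (∀ i → i ∈ ∁ J → + m ∣ g i) → ∣ ∑ᶻ[∈] J g ∣ < m → ∑ᶻ[∈] J g ≡ 0ℤ
small-subsum≡0 J g {m} m∣∑ m∣outside ∣∑J∣<m = n∣i∧∣i∣<n⇒i≡0
  (∣m+n∣n⇒∣m (subst (+ m ∣_) (sym (∑ᶻ[∈]-∁ J g)) m∣∑) (∣-∑ᶻ[∈] (∁ J) m∣outside))
  ∣∑J∣<m

module _ {c ℓ₁ ℓ₂} (O : TotalPreorder c ℓ₁ ℓ₂) where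
  open TotalPreorder O using (Carrier; _≲_; total) renaming (refl to ≲-refl; trans to ≲-trans)

  ∃-minimum : ∀ {n} (u : Fin (suc n) → Carrier) → ∃ λ i → ∀ j → u i ≲ u j
  ∃-minimum {zero}  u = zero , λ { zero → ≲-refl }
  ∃-minimum {suc n} u with ∃-minimum (u ∘ suc)
  ... | i , min with total (u zero) (u (suc i))
  ...   | inj₁ u₀≲uᵢ = zero  , λ { zero → ≲-refl ; (suc j) → ≲-trans u₀≲uᵢ (min j) }
  ...   | inj₂ uᵢ≲u₀ = suc i , λ { zero → uᵢ≲u₀  ; (suc j) → min j }

missed-value : ∀ {n} (b : Fin (suc n) → ℕ) {i₀} → b i₀ ≡ 0 → ∃ λ (k : Fin (suc n)) → ∀ j → b j ≢ suc (toℕ k)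
missed-value {n} b {i₀} b₀≡0 = map₂ (λ ¬hit j hit → ¬hit (j , hit))
  (¬∀⟶∃¬ (suc n) _ (λ k → any? (λ j → b j ℕ.≟ suc (toℕ k))) ¬all-hit)
  where
  ¬all-hit : ¬ (∀ k → ∃ λ j → b j ≡ suc (toℕ k))
  ¬all-hit hit = ℕP.n≮n n (injective⇒≤ (g-injective ∘ punchOut-injective (i₀≢g _) (i₀≢g _)))
    where
    g : Fin (suc n) → Fin (suc n)
    g k = proj₁ (hit k)
    i₀≢g : ∀ k → i₀ ≢ g k
    i₀≢g k i₀≡gk = ℕP.0≢1+n (trans (sym b₀≡0) (trans (cong b i₀≡gk) (proj₂ (hit k))))
    g-injective : ∀ {k l} → g k ≡ g l → k ≡ l
    g-injective {k} {l} gk≡gl = toℕ-injective (ℕP.suc-injective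
      (trans (sym (proj₂ (hit k))) (trans (cong b gk≡gl) (proj₂ (hit l)))))

scale : ∀ {n} → (Fin n → ℤ) → ℕ
scale e = suc (sum (∣_∣ ∘ e))

depth : ∀ {n} → (Fin n → ℤ) → ℕ
depth {n} e = suc n ℕ.* scale e

vanishing-subsum : ∀ p .{{_ : NonTrivial p}} {n} (e : Fin (suc n) → ℤ) (w : Fin (suc n) → ℕ) {i₀} →
                   w i₀ ≡ 0 → + (p ^ depth e) ∣ ∑ᶻ[∈] ⊤ (λ i → e i ℤ.* + (p ^ w i)) →
                   ∃ λ J → i₀ ∈ J × ∑ᶻ[∈] J (λ i → e i ℤ.* + (p ^ w i)) ≡ 0ℤ
vanishing-subsum p {n} e w {i₀} w₀≡0 p^d∣∑ =
  J , ∈-toSubset⁺ below? layer₀<k , small-subsum≡0 J g (∣-trans M∣p^d p^d∣∑) M∣outside ∣∑J∣<M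
  where
  instance
    _ = ℕ.nonTrivial⇒nonZero p
  c = scale e
  layer : Fin (suc n) → ℕ
  layer j = w j / c
  layer₀≡0 : layer i₀ ≡ 0
  layer₀≡0 = trans (cong (_/ c) w₀≡0) (0/n≡0 c)
  missed = missed-value layer layer₀≡0
  k = suc (toℕ (proj₁ missed))
  below? : Decidable (λ j → layer j < k)
  below? j = layer j ℕ.<? k
  J = toSubset below?
  layer₀<k : layer i₀ < k
  layer₀<k = subst (_< k) (sym layer₀≡0) (s≤s z≤n)
  g : Fin (suc n) → ℤ
  g i = e i ℤ.* + (p ^ w i)
  M = p ^ (suc k ℕ.* c)
  P = p ^ (k ℕ.* c)
  instance
    _ = ℕP.m^n≢0 p (k ℕ.* c)
  M∣outside : ∀ j → j ∈ ∁ J → + M ∣ g j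
  M∣outside j j∈∁J = ∣n⇒∣m*n (e j) (∣ᵤ⇒∣ (^-monoʳ-∣ p {suc k ℕ.* c} {w j} (o≤m/n⇒o*n≤m k<layer)))
    where
    k<layer : k < layer j
    k<layer = ℕP.≤∧≢⇒< (ℕP.≮⇒≥ (x∈∁p⇒x∉p j∈∁J ∘ ∈-toSubset⁺ below?)) (proj₂ missed j ∘ sym)
  M∣p^d : + M ∣ + (p ^ depth e)
  M∣p^d = ∣ᵤ⇒∣ (^-monoʳ-∣ p {suc k ℕ.* c} {depth e} (ℕP.*-monoˡ-≤ c (s≤s (toℕ<n (proj₁ missed)))))
  ∣g∣≤ : ∀ j → j ∈ J → ∣ g j ∣ ≤ ∣ e j ∣ ℕ.* P
  ∣g∣≤ j j∈J = ℕP.≤-trans (ℕP.≤-reflexive (ℤP.abs-* (e j) (+ (p ^ w j))))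
    (ℕP.*-monoʳ-≤ ∣ e j ∣ (ℕP.^-monoʳ-≤ p {w j} {k ℕ.* c} (ℕP.<⇒≤ (m/n<o⇒m<o*n (∈-toSubset⁻ below? j∈J)))))
  ∣∑J∣<M : ∣ ∑ᶻ[∈] J g ∣ < M
  ∣∑J∣<M = begin-strict
    ∣ ∑ᶻ[∈] J g ∣               ≤⟨ ∣∑ᶻ[∈]∣≤ J (λ j → ∣ e j ∣ ℕ.* P) ∣g∣≤ ⟩
    sum (λ j → ∣ e j ∣ ℕ.* P)   ≡⟨ *-distribʳ-sum P (∣_∣ ∘ e) ⟨
    sum (∣_∣ ∘ e) ℕ.* P         <⟨ ℕP.*-monoˡ-< P (ℕP.<-trans (ℕP.n<1+n _) (n<m^n (ℕ.nonTrivial⇒n>1 p) c)) ⟩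
    p ^ c ℕ.* P                 ≡⟨ ℕP.^-distribˡ-+-* p c (k ℕ.* c) ⟨
    M                           ∎
    where open ℕP.≤-Reasoning

no-deep-minimum : ∀ p (pp : Prime p) {n} (e u : Fin (suc n) → ℤ) {z} → z ≢ 0ℤ → ∑ (term p pp e u) ≡ ℤ→ℚ z →
                  (∀ J → Nonempty J → J ≢ ⊤ → ∑[∈] J (term p pp e u) ≢ 0ℚ) →
                  ∀ {i₀ D} → (∀ j → u i₀ ≤ℤ u j) → u i₀ ℤ.+ + D ≡ 0ℤ → depth e ≤ D → ⊥
no-deep-minimum p pp e u {z} z≢0 ∑≡z irreducible {i₀} {D} min u₀+D≡0 d≤D =
  vanishing⇒⊥ (vanishing-subsum p e w (cong ∣_∣ u₀+D≡0) p^d∣∑⊤)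
  where
  instance
    _ = prime⇒nonTrivial pp
  w : Fin _ → ℕ
  w j = ∣ u j ℤ.+ + D ∣
  u+D≡w : ∀ j → u j ℤ.+ + D ≡ + w j
  u+D≡w j = sym (ℤP.0≤i⇒+∣i∣≡i (subst (_≤ℤ u j ℤ.+ + D) u₀+D≡0 (ℤP.+-monoˡ-≤ (+ D) (min j))))
  g : Fin _ → ℤ
  g j = e j ℤ.* + (p ^ w j)
  scaled = ∑[∈]-term-* p pp e u u+D≡w
  ∑⊤≡z*p^D : ∑ᶻ[∈] ⊤ g ≡ z ℤ.* + (p ^ D)
  ∑⊤≡z*p^D = ℤ→ℚ-injective (begin
    ℤ→ℚ (∑ᶻ[∈] ⊤ g)                                ≡⟨ scaled ⊤ ⟨
    ∑[∈] ⊤ (term p pp e u) ℚ.* ℤ→ℚ (+ (p ^ D))     ≡⟨ cong (ℚ._* ℤ→ℚ (+ (p ^ D))) (trans (∑[∈]-⊤ (term p pp e u)) ∑≡z) ⟩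
    ℤ→ℚ z ℚ.* ℤ→ℚ (+ (p ^ D))                      ≡⟨ ℤ→ℚ-homo-* z (+ (p ^ D)) ⟨
    ℤ→ℚ (z ℤ.* + (p ^ D))                          ∎)
    where open ≡-Reasoning
  p^d∣∑⊤ : + (p ^ depth e) ∣ ∑ᶻ[∈] ⊤ g
  p^d∣∑⊤ = subst (+ (p ^ depth e) ∣_) (sym ∑⊤≡z*p^D) (∣n⇒∣m*n z (∣ᵤ⇒∣ (^-monoʳ-∣ p d≤D)))
  term≡0 : ∀ J → ∑ᶻ[∈] J g ≡ 0ℤ → ∑[∈] J (term p pp e u) ≡ 0ℚ
  term≡0 J ∑J≡0 = x*n≡0⇒x≡0 (p ^ D) {{ℕP.m^n≢0 p D {{prime⇒nonZero pp}}}} (trans (scaled J) (cong ℤ→ℚ ∑J≡0))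
  vanishing⇒⊥ : (∃ λ J → i₀ ∈ J × ∑ᶻ[∈] J g ≡ 0ℤ) → ⊥
  vanishing⇒⊥ (J , i₀∈J , ∑J≡0) with ≡-dec _≟ᵇ_ J ⊤
  ... | no  J≢⊤ = irreducible J (i₀ , i₀∈J) J≢⊤ (term≡0 J ∑J≡0)
  ... | yes J≡⊤ = z≢0 (ℤ→ℚ-injective (begin
    ℤ→ℚ z                     ≡⟨ ∑≡z ⟨
    ∑ (term p pp e u)         ≡⟨ ∑[∈]-⊤ (term p pp e u) ⟨
    ∑[∈] ⊤ (term p pp e u)    ≡⟨ cong (λ K → ∑[∈] K (term p pp e u)) J≡⊤ ⟨
    ∑[∈] J (term p pp e u)    ≡⟨ term≡0 J ∑J≡0 ⟩
    0ℚ                        ∎))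
    where open ≡-Reasoning

exponents-bounded : ∀ p (pp : Prime p) {n} (e u : Fin (suc n) → ℤ) {z} → z ≢ 0ℤ → ∑ (term p pp e u) ≡ ℤ→ℚ z →
                    (∀ J → Nonempty J → J ≢ ⊤ → ∑[∈] J (term p pp e u) ≢ 0ℚ) →
                    ∀ i → 0ℤ ≤ℤ u i ℤ.+ + depth e
exponents-bounded p pp e u z≢0 ∑≡z irreducible i =
  ℤP.≤-trans 0≤u₀+d (ℤP.+-monoˡ-≤ (+ depth e) (min i))
  where
  i₀ = proj₁ (∃-minimum ℤP.≤-totalPreorder u)
  min = proj₂ (∃-minimum ℤP.≤-totalPreorder u)
  0≤u₀+d : 0ℤ ≤ℤ u i₀ ℤ.+ + depth e
  0≤u₀+d with 0≤i+n⊎i+D≡0 (u i₀) (depth e)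
  ... | inj₁ nonneg             = nonneg
  ... | inj₂ (D , d≤D , u₀+D≡0) = ⊥-elim (no-deep-minimum p pp e u z≢0 ∑≡z irreducible min u₀+D≡0 d≤D)

lemma2p4 : (p : ℕ) → (pp : Prime p) → (N : ℕ) → 1 ≤ N → (e : Fin N → ℤ) →
  ∃[ C₁ ] ((u : Fin N → ℤ) →
    (∃[ z ] (z ≢ 0ℤ × ∑ (term p pp e u) ≡ ℤ→ℚ z)) →
    ((J : Subset N) → Nonempty J → J ≢ ⊤ → ∑[∈] J (term p pp e u) ≢ 0ℚ) →
    (i : Fin N) → 0ℤ ≤ℤ u i + C₁)
lemma2p4 p pp zero    () e
lemma2p4 p pp (suc n) _  e = + depth e , λ u (z , z≢0 , ∑≡z) → exponents-bounded p pp e u z≢0 ∑≡z
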